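{- If $G$ and $H$ are Left dead ends with $G\geq H$, then $\operatorname{flex}(G)\leq\operatorname{flex}(H)$.
   Context: All games are short partizan combinatorial game forms; $G+H$ is the disjunctive sum; $\cong$ denotes identity of game forms. Play is misère (a player unable to move wins). Misère outcome classes are ordered $\mathscr L>\mathscr P>\mathscr R$ and $\mathscr L>\mathscr N>\mathscr R$; $G\geq H$ means that for every game $X$ the misère outcome of $G+X$ is $\geq$ that of $H+X$. A Left dead end is a game no subposition of which (including itself) has a Left option; its options are its Right options. Let $0=\{\cdot\mid\cdot\}$, $\overline{0}=0$ and $\overline{n}=\{\cdot\mid\overline{n-1}\}$ for $n\geq1$; a Left dead end is an integer if it is isomorphic to $\overline{n}$ for some $n\ge0$. The flexibility $\operatorname{flex}(G)$ of a Left dead end is defined recursively: $\operatorname{flex}(G)=0$ if $G$ is an integer, and otherwise $\operatorname{flex}(G)=1+\max_{G'}\operatorname{flex}(G')$, where $G'$ ranges over the options of $G$. -}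

module Defs where

open import Data.Nat using (ℕ; zero; suc; _≤_)
open import Data.List using (List; []; _∷_; _++_)
open import Data.List.Relation.Unary.All using (All)
open import Data.List.Relation.Unary.Any using (Any)
open import Data.Product using (_×_; ∃)
open import Relation.Nullary using (¬_)
open import Relation.Binary.PropositionalEquality using (_≡_)

data Game : Set where
  ⟨_∣_⟩ : List Game → List Game → Game

leftOpts : Game → List Game
leftOpts ⟨ l ∣ r ⟩ = l

rightOpts : Game → List Game
rightOpts ⟨ l ∣ r ⟩ = r

mutual
  infixl 6 _⊕_
  _⊕_ : Game → Game → Game
  g@(⟨ gl ∣ gr ⟩) ⊕ h@(⟨ hl ∣ hr ⟩) =
    ⟨ sumL gl h ++ sumR g hl ∣ sumL gr h ++ sumR g hr ⟩

  sumL : List Game → Game → List Game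
  sumL [] h = []
  sumL (g ∷ gs) h = (g ⊕ h) ∷ sumL gs h

  sumR : Game → List Game → List Game
  sumR g [] = []
  sumR g (h ∷ hs) = (g ⊕ h) ∷ sumR g hs

-- Misère play: a player unable to move wins.
-- LeftWinsFirst G  : Left, moving first in G, has a winning strategy.
-- LeftWinsSecond G : Left wins G when Right moves first.
mutual
  data LeftWinsFirst (G : Game) : Set where
    noLeftMove : leftOpts G ≡ [] → LeftWinsFirst G
    goodLeftMove : Any LeftWinsSecond (leftOpts G) → LeftWinsFirst G

  data LeftWinsSecond (G : Game) : Set where
    allRightMovesLose : ¬ (rightOpts G ≡ []) → All LeftWinsFirst (rightOpts G) → LeftWinsSecond G

-- Misère outcome order (L > P > R, L > N > R): o(A) ≥ o(B) iff whenever Left wins B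
-- moving first, Left wins A moving first, and whenever Left wins B moving second,
-- Left wins A moving second.
_≥ₒ_ : Game → Game → Set
A ≥ₒ B = (LeftWinsFirst B → LeftWinsFirst A) × (LeftWinsSecond B → LeftWinsSecond A)

_≥ₘ_ : Game → Game → Set
G ≥ₘ H = (X : Game) → (G ⊕ X) ≥ₒ (H ⊕ X)

-- Identity (isomorphism) of game forms: option sets agree up to identity
-- (game forms have *sets* of options, so list order/multiplicity is irrelevant).
data _≅_ (G H : Game) : Set where
  iso : All (λ g → Any (g ≅_) (leftOpts H)) (leftOpts G)
      → All (λ h → Any (_≅ h) (leftOpts G)) (leftOpts H)
      → All (λ g → Any (g ≅_) (rightOpts H)) (rightOpts G)
      → All (λ h → Any (_≅ h) (rightOpts G)) (rightOpts H)
      → G ≅ H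

data LeftDeadEnd (G : Game) : Set where
  lde : leftOpts G ≡ [] → All LeftDeadEnd (rightOpts G) → LeftDeadEnd G

intGame : ℕ → Game
intGame zero = ⟨ [] ∣ [] ⟩
intGame (suc n) = ⟨ [] ∣ intGame n ∷ [] ⟩

IsInteger : Game → Set
IsInteger G = ∃ λ n → G ≅ intGame n

-- Flexibility, given as the graph of the recursive function:
-- flex G = 0 if G is an integer, else 1 + max over the options G' of flex G'.
-- (For a Left dead end the options are its Right options.)
data Flex (G : Game) : ℕ → Set where
  flexInt : IsInteger G → Flex G zero
  flexStep : (m : ℕ) → ¬ IsInteger G
           → All (λ G' → ∃ λ k → Flex G' k × k ≤ m) (rightOpts G)
           → Any (λ G' → Flex G' m) (rightOpts G)
           → Flex G (suc m)

{-# OPTIONS --safe #-}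
module Submission where

-- For a Left dead end H, G ≥ H follows from outcomes with Left moving second alone: if Left
-- wins H + X moving first, he wins H + {· ∣ X} moving second (after any Right move in H he has
-- no move), and winning G + {· ∣ X} moving second includes winning G + X moving first.
-- Hence if G ≥ H and some Right option G' of G lies above no Right option H' of H, there are
-- games Y_H' that Left wins in H' + Y_H' but not in G' + Y_H' when moving second, and
-- Z = {chain, Y_H', … ∣ 0} is won by Left moving second in H + Z but not in G + Z (Right moves
-- to G' + Z), where the chain of Left moves outlasts Right's run in G'. This maintenance
-- property makes G an integer n̄ whenever H is, and matches each option realising flex G with
-- an option of H of no smaller flexibility. The classical steps take place in the
-- double-negation monad, which suffices because a ≤ b is decidable.

open import Defs
open import Data.Nat using (ℕ; zero; suc; _≤_; z≤n; s≤s)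
open import Data.Nat.Properties using (≤-trans; _≤?_)
open import Data.List using (List; []; _∷_; _++_; map)
open import Data.List.Relation.Unary.All as All using (All; []; _∷_; sequenceM)
import Data.List.Relation.Unary.All.Properties as All
open import Data.List.Relation.Unary.Any as Any using (Any; here; there)
import Data.List.Relation.Unary.Any.Properties as Any
open import Data.List.Membership.Propositional using (_∈_; find)
open import Data.Product using (_×_; _,_; ∃; proj₁; proj₂; uncurry)
open import Function using (_∘_)
open import Data.Sum using (_⊎_; inj₁; inj₂)
open import Effect.Monad using (RawMonad)
open import Level using (0ℓ)
open import Relation.Nullary using (¬_; Dec; yes; no)
open import Relation.Nullary.Decidable using (map′; _×-dec_; _⊎-dec_; decidable-stable)
open import Relation.Nullary.Negation using (¬¬-Monad; contradiction)
open import Relation.Binary.PropositionalEquality using (_≡_; _≢_; refl; sym; cong; subst)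

open RawMonad (¬¬-Monad {0ℓ})

mutual
  leftWinsFirst? : (G : Game) → Dec (LeftWinsFirst G)
  leftWinsFirst? ⟨ [] ∣ _ ⟩ = yes (noLeftMove refl)
  leftWinsFirst? ⟨ Gs@(_ ∷ _) ∣ _ ⟩ =
    map′ goodLeftMove (λ { (noLeftMove ()) ; (goodLeftMove w) → w }) (anyLeftWinsSecond? Gs)

  leftWinsSecond? : (G : Game) → Dec (LeftWinsSecond G)
  leftWinsSecond? ⟨ _ ∣ [] ⟩ = no λ { (allRightMovesLose ne _) → ne refl }
  leftWinsSecond? ⟨ _ ∣ Gs@(_ ∷ _) ⟩ =
    map′ (allRightMovesLose λ ()) (λ { (allRightMovesLose _ w) → w }) (allLeftWinsFirst? Gs)

  anyLeftWinsSecond? : (Gs : List Game) → Dec (Any LeftWinsSecond Gs)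
  anyLeftWinsSecond? [] = no λ ()
  anyLeftWinsSecond? (G ∷ Gs) =
    map′ Any.fromSum Any.toSum (leftWinsSecond? G ⊎-dec anyLeftWinsSecond? Gs)

  allLeftWinsFirst? : (Gs : List Game) → Dec (All LeftWinsFirst Gs)
  allLeftWinsFirst? [] = yes []
  allLeftWinsFirst? (G ∷ Gs) =
    map′ (uncurry _∷_) All.uncons (leftWinsFirst? G ×-dec allLeftWinsFirst? Gs)

sumL≡map : (Gs : List Game) (H : Game) → sumL Gs H ≡ map (_⊕ H) Gs
sumL≡map [] H = refl
sumL≡map (G ∷ Gs) H = cong (G ⊕ H ∷_) (sumL≡map Gs H)

sumR≡map : (G : Game) (Hs : List Game) → sumR G Hs ≡ map (G ⊕_) Hs
sumR≡map G [] = refl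
sumR≡map G (H ∷ Hs) = cong (G ⊕ H ∷_) (sumR≡map G Hs)

leftOpts-⊕ : (G H : Game)
           → leftOpts (G ⊕ H) ≡ map (_⊕ H) (leftOpts G) ++ map (G ⊕_) (leftOpts H)
leftOpts-⊕ G@(⟨ Gl ∣ _ ⟩) H@(⟨ Hl ∣ _ ⟩) rewrite sumL≡map Gl H | sumR≡map G Hl = refl

rightOpts-⊕ : (G H : Game)
            → rightOpts (G ⊕ H) ≡ map (_⊕ H) (rightOpts G) ++ map (G ⊕_) (rightOpts H)
rightOpts-⊕ G@(⟨ _ ∣ Gr ⟩) H@(⟨ _ ∣ Hr ⟩) rewrite sumL≡map Gr H | sumR≡map G Hr = refl

rightOpts-⊕-≡[]⁺ : {G H : Game} → rightOpts G ≡ [] → rightOpts H ≡ [] → rightOpts (G ⊕ H) ≡ []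
rightOpts-⊕-≡[]⁺ {⟨ _ ∣ [] ⟩} {⟨ _ ∣ [] ⟩} refl refl = refl

rightOpts-⊕-≡[]⁻ : {G H : Game} → rightOpts (G ⊕ H) ≡ [] → rightOpts G ≡ [] × rightOpts H ≡ []
rightOpts-⊕-≡[]⁻ {⟨ _ ∣ [] ⟩} {⟨ _ ∣ [] ⟩} _ = refl , refl
rightOpts-⊕-≡[]⁻ {⟨ _ ∣ [] ⟩} {⟨ _ ∣ _ ∷ _ ⟩} ()
rightOpts-⊕-≡[]⁻ {⟨ _ ∣ _ ∷ _ ⟩} {⟨ _ ∣ _ ⟩} ()

leftWinsSecond⇒rightOpts≢[] : {G : Game} → LeftWinsSecond G → rightOpts G ≢ []
leftWinsSecond⇒rightOpts≢[] (allRightMovesLose someMove _) = someMove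

leftWinsSecond-⊕⁺ : {G H : Game} → ¬ (rightOpts G ≡ [] × rightOpts H ≡ [])
                  → All (λ G' → LeftWinsFirst (G' ⊕ H)) (rightOpts G)
                  → All (λ H' → LeftWinsFirst (G ⊕ H')) (rightOpts H)
                  → LeftWinsSecond (G ⊕ H)
leftWinsSecond-⊕⁺ {G} {H} someMove wG wH =
  allRightMovesLose (someMove ∘ rightOpts-⊕-≡[]⁻ {G} {H})
    (subst (All LeftWinsFirst) (sym (rightOpts-⊕ G H)) (All.++⁺ (All.map⁺ wG) (All.map⁺ wH)))

leftWinsSecond-⊕⁻ : {G H : Game} → LeftWinsSecond (G ⊕ H)
                  → All (λ G' → LeftWinsFirst (G' ⊕ H)) (rightOpts G)
                  × All (λ H' → LeftWinsFirst (G ⊕ H')) (rightOpts H)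
leftWinsSecond-⊕⁻ {G} {H} (allRightMovesLose _ w)
  with All.++⁻ (map (_⊕ H) (rightOpts G)) (subst (All LeftWinsFirst) (rightOpts-⊕ G H) w)
... | wG , wH = All.map⁻ wG , All.map⁻ wH

leftWinsFirst-⊕-noLeftOpts : {G H : Game} → leftOpts G ≡ [] → leftOpts H ≡ []
                           → LeftWinsFirst (G ⊕ H)
leftWinsFirst-⊕-noLeftOpts {⟨ [] ∣ _ ⟩} {⟨ [] ∣ _ ⟩} refl refl = noLeftMove refl

leftWinsFirst-⊕-deadEnds : {Gs : List Game} {H : Game} → All LeftDeadEnd Gs → leftOpts H ≡ []
                         → All (λ G → LeftWinsFirst (G ⊕ H)) Gs
leftWinsFirst-⊕-deadEnds deadGs Hᴸ≡[] =
  All.map (λ { (lde Gᴸ≡[] _) → leftWinsFirst-⊕-noLeftOpts Gᴸ≡[] Hᴸ≡[] }) deadGs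

leftWinsFirst-⊕⁺ʳ : {G H : Game} → Any (λ H' → LeftWinsSecond (G ⊕ H')) (leftOpts H)
                  → LeftWinsFirst (G ⊕ H)
leftWinsFirst-⊕⁺ʳ {G} {H} w =
  goodLeftMove (subst (Any LeftWinsSecond) (sym (leftOpts-⊕ G H)) (Any.++⁺ʳ _ (Any.map⁺ w)))

leftWinsFirst-⊕⁻ : {G H : Game} → leftOpts G ≡ [] → LeftWinsFirst (G ⊕ H)
                 → leftOpts H ≡ [] ⊎ Any (λ H' → LeftWinsSecond (G ⊕ H')) (leftOpts H)
leftWinsFirst-⊕⁻ {⟨ [] ∣ _ ⟩} {⟨ [] ∣ _ ⟩} refl _ = inj₁ refl
leftWinsFirst-⊕⁻ {⟨ [] ∣ _ ⟩} {⟨ _ ∷ _ ∣ _ ⟩} refl (noLeftMove ())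
leftWinsFirst-⊕⁻ {G@(⟨ [] ∣ _ ⟩)} {⟨ Hl@(_ ∷ _) ∣ _ ⟩} refl (goodLeftMove w) =
  inj₂ (Any.map⁻ (subst (Any LeftWinsSecond) (sumR≡map G Hl) w))

≥ₘ-fromLeftWinsSecond : {G H : Game} → LeftDeadEnd H
                      → (∀ X → LeftWinsSecond (H ⊕ X) → LeftWinsSecond (G ⊕ X)) → G ≥ₘ H
≥ₘ-fromLeftWinsSecond {G} {H} (lde _ deadHs) second X = first , second X
  where
  Y : Game
  Y = ⟨ [] ∣ X ∷ [] ⟩

  first : LeftWinsFirst (H ⊕ X) → LeftWinsFirst (G ⊕ X)
  first wHX = All.head (proj₂ (leftWinsSecond-⊕⁻ (second Y wHY)))
    where
    wHY : LeftWinsSecond (H ⊕ Y)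
    wHY = leftWinsSecond-⊕⁺ (λ { (_ , ()) }) (leftWinsFirst-⊕-deadEnds deadHs refl) (wHX ∷ [])

separatingGame : {G H : Game} → LeftDeadEnd H → ¬ G ≥ₘ H
               → ¬ ¬ ∃ λ Y → LeftWinsSecond (H ⊕ Y) × ¬ LeftWinsSecond (G ⊕ Y)
separatingGame deadH G≱H noSeparator = G≱H (≥ₘ-fromLeftWinsSecond deadH λ X wHX →
  decidable-stable (leftWinsSecond? _) λ ¬wGX → noSeparator (X , wHX , ¬wGX))

separatingGames : {G : Game} {Hs : List Game} → All LeftDeadEnd Hs → All (λ H → ¬ G ≥ₘ H) Hs
                → ¬ ¬ ∃ λ Ys → All (λ Y → ¬ LeftWinsSecond (G ⊕ Y)) Ys
                             × All (λ H → Any (λ Y → LeftWinsSecond (H ⊕ Y)) Ys) Hs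
separatingGames [] [] = pure ([] , [] , [])
separatingGames (deadH ∷ deadHs) (G≱H ∷ G≱Hs) = do
  (Y , wHY , ¬wGY) ← separatingGame deadH G≱H
  (Ys , ¬wGYs , wHsYs) ← separatingGames deadHs G≱Hs
  pure (Y ∷ Ys , ¬wGY ∷ ¬wGYs , here wHY ∷ All.map there wHsYs)

leftChain : ℕ → Game
leftChain zero = ⟨ [] ∣ [] ⟩
leftChain (suc n) = ⟨ leftChain n ∷ [] ∣ [] ⟩

firstRightRun : Game → ℕ
firstRightRun ⟨ _ ∣ [] ⟩ = 0
firstRightRun ⟨ _ ∣ G' ∷ _ ⟩ = suc (firstRightRun G')

-- Right always plays his first option in G, while Left can only walk down the chain;
-- Right is the first to be left without a move.
¬leftWinsSecond-leftChain : {G : Game} → LeftDeadEnd G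
                          → ¬ LeftWinsSecond (G ⊕ leftChain (firstRightRun G))
¬leftWinsSecond-leftChain {⟨ _ ∣ [] ⟩} _ (allRightMovesLose noMove _) = noMove refl
¬leftWinsSecond-leftChain {⟨ _ ∣ G' ∷ _ ⟩} (lde _ (deadG'@(lde G'ᴸ≡[] _) ∷ _))
                          (allRightMovesLose _ (wG'C ∷ _))
  with leftWinsFirst-⊕⁻ G'ᴸ≡[] wG'C
... | inj₂ (here wG'C') = ¬leftWinsSecond-leftChain deadG' wG'C'

testGame : Game → List Game → Game
testGame G' Ys = ⟨ leftChain (firstRightRun G') ∷ Ys ∣ intGame 0 ∷ [] ⟩

¬leftWinsFirst-testGame : {G' : Game} {Ys : List Game} → LeftDeadEnd G'
                        → All (λ Y → ¬ LeftWinsSecond (G' ⊕ Y)) Ys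
                        → ¬ LeftWinsFirst (G' ⊕ testGame G' Ys)
¬leftWinsFirst-testGame deadG'@(lde G'ᴸ≡[] _) ¬wG'Ys wG'Z with leftWinsFirst-⊕⁻ G'ᴸ≡[] wG'Z
... | inj₂ (here wG'C) = ¬leftWinsSecond-leftChain deadG' wG'C
... | inj₂ (there wG'Ys) = All.All¬⇒¬Any ¬wG'Ys wG'Ys

leftWinsSecond-testGame : {G' H : Game} {Ys : List Game} → leftOpts H ≡ []
                        → All (λ H' → Any (λ Y → LeftWinsSecond (H' ⊕ Y)) Ys) (rightOpts H)
                        → LeftWinsSecond (H ⊕ testGame G' Ys)
leftWinsSecond-testGame Hᴸ≡[] wHsYs = leftWinsSecond-⊕⁺ (λ { (_ , ()) })
  (All.map (leftWinsFirst-⊕⁺ʳ ∘ there) wHsYs)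
  (leftWinsFirst-⊕-noLeftOpts Hᴸ≡[] refl ∷ [])

rightOption-≥ₘ : {G G' H : Game} → LeftDeadEnd G' → G' ∈ rightOpts G → LeftDeadEnd H → G ≥ₘ H
               → ¬ ¬ Any (G' ≥ₘ_) (rightOpts H)
rightOption-≥ₘ {G} {G'} deadG' G'∈ (lde Hᴸ≡[] deadHs) G≥H G'≱Hs =
  separatingGames deadHs (All.¬Any⇒All¬ _ G'≱Hs) λ (Ys , ¬wG'Ys , wHsYs) →
    ¬leftWinsFirst-testGame deadG' ¬wG'Ys
      (All.lookup (proj₁ (leftWinsSecond-⊕⁻ (proj₂ (G≥H (testGame G' Ys))
        (leftWinsSecond-testGame Hᴸ≡[] wHsYs)))) G'∈)

rightOpts-≥ₘ : {G H : Game} → LeftDeadEnd H → G ≥ₘ H → rightOpts H ≢ [] → rightOpts G ≢ []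
rightOpts-≥ₘ {G} {H} (lde _ deadHs) G≥H Hᴿ≢[] Gᴿ≡[] =
  leftWinsSecond⇒rightOpts≢[] (proj₂ (G≥H (intGame 0)) wH0)
    (rightOpts-⊕-≡[]⁺ {G} {intGame 0} Gᴿ≡[] refl)
  where
  wH0 : LeftWinsSecond (H ⊕ intGame 0)
  wH0 = leftWinsSecond-⊕⁺ (Hᴿ≢[] ∘ proj₁) (leftWinsFirst-⊕-deadEnds deadHs refl) []

≅-intGame-suc⁻ : {H : Game} {n : ℕ} → H ≅ intGame (suc n)
               → rightOpts H ≢ [] × All (_≅ intGame n) (rightOpts H)
≅-intGame-suc⁻ {⟨ _ ∣ [] ⟩} (iso _ _ _ (() ∷ []))
≅-intGame-suc⁻ {⟨ _ ∣ _ ∷ _ ⟩} (iso _ _ Hᴿ≅ _) = (λ ()) , All.map Any.singleton⁻ Hᴿ≅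

≅-intGame-suc⁺ : {G : Game} {n : ℕ} → leftOpts G ≡ [] → rightOpts G ≢ []
               → All (_≅ intGame n) (rightOpts G)
               → G ≅ intGame (suc n)
≅-intGame-suc⁺ {⟨ [] ∣ [] ⟩} refl Gᴿ≢[] _ = contradiction refl Gᴿ≢[]
≅-intGame-suc⁺ {⟨ [] ∣ _ ∷ _ ⟩} refl _ (G'≅ ∷ Gᴿ≅) =
  iso [] [] (All.map here (G'≅ ∷ Gᴿ≅)) (here G'≅ ∷ [])

≥ₘ-intGame : (n : ℕ) {G H : Game} → LeftDeadEnd G → LeftDeadEnd H → G ≥ₘ H
           → H ≅ intGame n → ¬ ¬ (G ≅ intGame n)
≥ₘ-intGame zero {⟨ _ ∣ [] ⟩} (lde refl _) _ _ _ = pure (iso [] [] [] [])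
≥ₘ-intGame zero {⟨ _ ∣ _ ∷ _ ⟩} {⟨ _ ∣ [] ⟩} (lde _ (deadG' ∷ _)) deadH G≥H _ =
  rightOption-≥ₘ deadG' (here refl) deadH G≥H >>= λ ()
≥ₘ-intGame zero {_} {⟨ _ ∣ _ ∷ _ ⟩} _ _ _ (iso _ _ (() ∷ _) _)
≥ₘ-intGame (suc n) {G} (lde Gᴸ≡[] deadGs) deadH@(lde _ deadHs) G≥H H≅ with ≅-intGame-suc⁻ H≅
... | Hᴿ≢[] , Hᴿ≅ = do
  Gᴿ≅ ← sequenceM 0ℓ ¬¬-Monad (All.tabulate rightOption≅)
  pure (≅-intGame-suc⁺ Gᴸ≡[] (rightOpts-≥ₘ deadH G≥H Hᴿ≢[]) Gᴿ≅)
  where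
  rightOption≅ : {G' : Game} → G' ∈ rightOpts G → ¬ ¬ (G' ≅ intGame n)
  rightOption≅ G'∈ = do
    let deadG' = All.lookup deadGs G'∈
    G'≥ ← rightOption-≥ₘ deadG' G'∈ deadH G≥H
    let (H' , H'∈ , G'≥H') = find G'≥
    ≥ₘ-intGame n deadG' (All.lookup deadHs H'∈) G'≥H' (All.lookup Hᴿ≅ H'∈)

flex-antitone : (a : ℕ) {G H : Game} {b : ℕ} → LeftDeadEnd G → LeftDeadEnd H → G ≥ₘ H
              → Flex G a → Flex H b → ¬ ¬ (a ≤ b)
flex-antitone zero _ _ _ _ _ = pure z≤n
flex-antitone (suc _) deadG deadH G≥H (flexStep _ ¬intG _ _) (flexInt (n , H≅)) _ =
  ≥ₘ-intGame n deadG deadH G≥H H≅ λ G≅ → ¬intG (n , G≅)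
flex-antitone (suc m) (lde _ deadGs) deadH@(lde _ deadHs) G≥H
              (flexStep _ _ _ someG') (flexStep _ _ allH' _) = do
  let (G' , G'∈ , flexG') = find someG'
      deadG' = All.lookup deadGs G'∈
  G'≥ ← rightOption-≥ₘ deadG' G'∈ deadH G≥H
  let (H' , H'∈ , G'≥H') = find G'≥
      (k , flexH' , k≤) = All.lookup allH' H'∈
  m≤k ← flex-antitone m deadG' (All.lookup deadHs H'∈) G'≥H' flexG' flexH'
  pure (s≤s (≤-trans m≤k k≤))

mainTheorem9 : (G H : Game) → LeftDeadEnd G → LeftDeadEnd H → G ≥ₘ H
             → (a b : ℕ) → Flex G a → Flex H b → a ≤ b
mainTheorem9 G H deadG deadH G≥H a b flexG flexH =
  decidable-stable (a ≤? b) (flex-antitone a deadG deadH G≥H flexG flexH)
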